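{- Let $G$ be a directed graph, $T\subseteq V(G)$ a set of terminals and $p$ an integer. Construct a directed graph $G'$ as follows: for each $u\in V(G)\setminus T$ create a set $C_u$ consisting of $u$ and $p$ further copies of $u$; for $t\in T$ let $C_t=\{t\}$; for each edge $(u,v)\in E(G)$ create a vertex $\beta_{uv}$ and add the edges $(x,\beta_{uv})$ for all $x\in C_u$ and $(\beta_{uv},y)$ for all $y\in C_v$. Let $T'=\bigcup_{t\in T}C_t=T$ and let the set of distinguished vertices of $G'$ be $V^{\infty}(G')=T'$. Then $(G,T,p)$ is a yes-instance of Directed Edge Multiway Cut if and only if $(G',T',p)$ is a yes-instance of Directed Vertex Multiway Cut.
   Context: $(G,T,p)$ is a yes-instance of Directed Edge Multiway Cut if there is $S\subseteq E(G)$ with $|S|\le p$ such that $G\setminus S$ has no directed path between any two distinct terminals. $(G',T',p)$ with distinguished set $V^{\infty}(G')$ is a yes-instance of Directed Vertex Multiway Cut if there is $S\subseteq V(G')\setminus V^{\infty}(G')$ with $|S|\le p$ such that $G'\setminus S$ has no directed path between any two distinct terminals of $T'$. -}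

module Defs where

open import Data.Nat using (ℕ; suc; _≤_)
open import Data.Fin using (Fin)
open import Data.Fin.Subset using (Subset; _∈_; _∉_)
open import Data.Bool using (Bool; true)
open import Data.List using (List; length)
open import Data.List.Relation.Unary.All using (All)
import Data.List.Membership.Propositional as L
open import Data.Product using (_×_; _,_; ∃-syntax)
open import Relation.Binary.PropositionalEquality using (_≡_; _≢_)
open import Relation.Binary.Construct.Closure.Transitive using (TransClosure)
open import Relation.Nullary using (¬_)

-- A directed path of length ≥ 1 from a to b in a digraph with adjacency R
-- is an element of  TransClosure R a b.

EdgeMC : (n : ℕ) → (Fin n → Fin n → Bool) → Subset n → ℕ → Set
EdgeMC n E T p =
  ∃[ S ] (length S ≤ p
         × All (λ e → E (Data.Product.proj₁ e) (Data.Product.proj₂ e) ≡ true) S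
         × (∀ s t → s ∈ T → t ∈ T → s ≢ t →
              ¬ TransClosure (λ u v → (E u v ≡ true) × ¬ ((u , v) L.∈ S)) s t))

VertexMC : (V : Set) → (V → V → Set) → (V → Set) → (V → Set) → ℕ → Set
VertexMC V Adj Term Inf p =
  ∃[ S ] (length S ≤ p
         × All (λ x → ¬ Inf x) S
         × (∀ a b → Term a → Term b → a ≢ b →
              ¬ TransClosure (λ x y → Adj x y × ¬ (x L.∈ S) × ¬ (y L.∈ S)) a b))

module Construction (n : ℕ) (E : Fin n → Fin n → Bool) (T : Subset n) (p : ℕ) where

  data V' : Set where
    -- the p+1 vertices of C_u for non-terminal u (index zero is u itself)
    cp   : (u : Fin n) → u ∉ T → Fin (suc p) → V'
    tm   : (t : Fin n) → t ∈ T → V'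
    β    : (u v : Fin n) → E u v ≡ true → V'

  data InC : Fin n → V' → Set where
    inCp : ∀ {u} (h : u ∉ T) (i : Fin (suc p)) → InC u (cp u h i)
    inTm : ∀ {t} (h : t ∈ T) → InC t (tm t h)

  data Adj' : V' → V' → Set where
    toβ   : ∀ {u v x} (e : E u v ≡ true) → InC u x → Adj' x (β u v e)
    fromβ : ∀ {u v y} (e : E u v ≡ true) → InC v y → Adj' (β u v e) y

  data T' : V' → Set where
    isT : ∀ {t} (h : t ∈ T) → T' (tm t h)

  V∞ : V' → Set
  V∞ = T'

module Submission where

-- (⇒) Given an edge cut S, delete the subdivision vertices β_uv for (u,v) ∈ S.
--     Every path of G' alternates between classes C_u and subdivision
--     vertices, so a path in G' ∖ S' from C_s to C_t projects to a path in
--     G ∖ S from s to t (`project`), which cannot exist.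
-- (⇐) Given a vertex cut S' (avoiding the terminals), keep the edges (u,v)
--     with β_uv ∈ S'.  Since |S'| ≤ p and every class C_u of a non-terminal
--     has p+1 copies, each C_u contains a copy avoided by S' (pigeonhole,
--     `missing-element`); routing an edge (u,v) of G ∖ S through β_uv between
--     these representatives lifts any path of G ∖ S to G' ∖ S' (`lift-path`).

open import Defs
open import Data.Nat using (ℕ; suc; _≤_; s≤s)
open import Data.Nat.Properties using (≤-trans; ≤-reflexive)
open import Data.Fin using (Fin)
open import Data.Fin.Properties using (pigeonhole; ¬∀⟶∃¬; <⇒≢) renaming (_≟_ to _≟ᶠ_)
open import Data.Fin.Subset using (Subset; _∈_; _∉_)
open import Data.Fin.Subset.Properties using (_∈?_)
open import Data.Bool using (Bool; true; if_then_else_)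
import Data.Bool.Properties as Bool
open import Data.Maybe using (Maybe; just; nothing)
import Data.Maybe.Relation.Unary.All as Maybe
import Data.Maybe.Relation.Unary.Any as Maybe
open import Data.List using (List; []; _∷_; length; lookup; mapMaybe)
open import Data.List.Properties using (length-mapMaybe)
open import Data.List.Relation.Unary.All using (All; []; _∷_; tabulate)
import Data.List.Relation.Unary.All.Properties as All
open import Data.List.Relation.Unary.Any using (here; there; index)
import Data.List.Relation.Unary.Any.Properties as Any
import Data.List.Membership.Propositional as L
import Data.List.Membership.DecPropositional
open import Data.Vec using (here; there)
open import Data.Product using (_×_; _,_; ∃-syntax; proj₁; proj₂)
open import Data.Sum using (_⊎_; inj₁; inj₂)
open import Function.Bundles using (_⇔_; mk⇔)
open import Relation.Binary.Core using (Rel)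
open import Relation.Binary.PropositionalEquality
  using (_≡_; _≢_; refl; cong; sym; subst; module ≡-Reasoning)
open import Relation.Binary.Construct.Closure.Transitive using (TransClosure; [_]; _∷_; _++_)
open import Relation.Nullary using (¬_; yes; no; does; contradiction)
open import Relation.Nullary.Decidable using (dec-true)
open import Axiom.UniquenessOfIdentityProofs using (module Decidable⇒UIP)

-- Pigeonhole for lists: at most p entries cannot cover all of Fin (suc p).
-- Membership is decidable, so the missing element can be computed.
missing-element : ∀ p (xs : List (Fin (suc p))) → length xs ≤ p → ∃[ i ] ¬ (i L.∈ xs)
missing-element p xs len = ¬∀⟶∃¬ (suc p) (L._∈ xs) (DecMembership._∈? xs) covers-not-all
  where
  module DecMembership = Data.List.Membership.DecPropositional _≟ᶠ_
  -- If every i occurred, i ↦ (position of i in xs) would inject Fin (suc p)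
  -- into Fin (length xs).
  covers-not-all : ¬ (∀ i → i L.∈ xs)
  covers-not-all covers with pigeonhole (s≤s len) (λ i → index (covers i))
  ... | i , j , i<j , same-position = <⇒≢ i<j (begin
    i                             ≡⟨ Any.lookup-index (covers i) ⟩
    lookup xs (index (covers i))  ≡⟨ cong (lookup xs) same-position ⟩
    lookup xs (index (covers j))  ≡⟨ sym (Any.lookup-index (covers j)) ⟩
    j                             ∎)
    where open ≡-Reasoning

lift-path : ∀ {a b ℓ ℓ'} {A : Set a} {B : Set b} {R : Rel A ℓ} {R' : Rel B ℓ'} (f : A → B) →
            (∀ {x y} → R x y → TransClosure R' (f x) (f y)) →
            ∀ {x y} → TransClosure R x y → TransClosure R' (f x) (f y)
lift-path f lift-step [ r ]    = lift-step r
lift-path f lift-step (r ∷ rs) = lift-step r ++ lift-path f lift-step rs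

∈-mapMaybe : ∀ {a b} {A : Set a} {B : Set b} (f : A → Maybe B) {x y} {xs : List A} →
             f x ≡ just y → x L.∈ xs → y L.∈ mapMaybe f xs
∈-mapMaybe f {y = y} {xs} fx≡y x∈xs =
  Any.mapMaybe⁺ f xs (Any.gmap (λ { refl → subst (Maybe.Any (y ≡_)) (sym fx≡y) (Maybe.just refl) }) x∈xs)

∈-irrelevant : ∀ {m} {T : Subset m} {t} (h h' : t ∈ T) → h ≡ h'
∈-irrelevant here      here       = refl
∈-irrelevant (there h) (there h') = cong there (∈-irrelevant h h')

module Reduction (n : ℕ) (E : Fin n → Fin n → Bool) (T : Subset n) (p : ℕ) where
  open Construction n E T p

  IsEdge : Fin n × Fin n → Set
  IsEdge (u , v) = E u v ≡ true

  G∖_ : List (Fin n × Fin n) → Fin n → Fin n → Set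
  G∖ S = λ u v → (E u v ≡ true) × ¬ ((u , v) L.∈ S)

  G'∖_ : List V' → V' → V' → Set
  G'∖ S' = λ x y → Adj' x y × ¬ (x L.∈ S') × ¬ (y L.∈ S')

  InC-functional : ∀ {u w x} → InC u x → InC w x → u ≡ w
  InC-functional (inCp _ i) (inCp _ .i) = refl
  InC-functional (inTm _)   (inTm _)    = refl

  tm-distinct : ∀ {s t} (hs : s ∈ T) (ht : t ∈ T) → tm s hs ≢ tm t ht → s ≢ t
  tm-distinct hs ht tms≢tmt refl = tms≢tmt (cong (tm _) (∈-irrelevant hs ht))

  subdivisions : ∀ {S} → All IsEdge S → List V'
  subdivisions []                     = []
  subdivisions {(u , v) ∷ _} (e ∷ es) = β u v e ∷ subdivisions es

  length-subdivisions : ∀ {S} (es : All IsEdge S) → length (subdivisions es) ≡ length S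
  length-subdivisions []       = refl
  length-subdivisions (_ ∷ es) = cong suc (length-subdivisions es)

  subdivisions-deletable : ∀ {S} (es : All IsEdge S) → All (λ x → ¬ V∞ x) (subdivisions es)
  subdivisions-deletable []       = []
  subdivisions-deletable (_ ∷ es) = (λ ()) ∷ subdivisions-deletable es

  -- The proof of E u v ≡ true carried by β does not matter (UIP for Bool).
  ∈-subdivisions : ∀ {S} (es : All IsEdge S) {u v} (e : E u v ≡ true) →
                   (u , v) L.∈ S → β u v e L.∈ subdivisions es
  ∈-subdivisions (e' ∷ _) e (here refl)
    rewrite Decidable⇒UIP.≡-irrelevant Bool._≟_ e e' = here refl
  ∈-subdivisions (_ ∷ es) e (there uv∈S) = there (∈-subdivisions es e uv∈S)

  module FromEdgeCut (S : List (Fin n × Fin n)) (S⊆E : All IsEdge S) where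

    S' : List V'
    S' = subdivisions S⊆E

    kept-edge : ∀ {u v} (e : E u v ≡ true) → ¬ (β u v e L.∈ S') → (G∖ S) u v
    kept-edge e β∉S' = e , λ uv∈S → β∉S' (∈-subdivisions S⊆E e uv∈S)

    project   : ∀ {u w x y} → InC u x → TransClosure (G'∖ S') x y → InC w y →
                TransClosure (G∖ S) u w
    project-β : ∀ {u v w y} (e : E u v ≡ true) → ¬ (β u v e L.∈ S') →
                TransClosure (G'∖ S') (β u v e) y → InC w y → (v ≡ w) ⊎ TransClosure (G∖ S) v w
    project x∈Cu [ (toβ _ _ , _) ] ()
    project x∈Cu ((toβ e x∈Cu' , _ , β∉S') ∷ rest) y∈Cw
      with refl ← InC-functional x∈Cu x∈Cu'
      with project-β e β∉S' rest y∈Cw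
    ... | inj₁ refl = [ kept-edge e β∉S' ]
    ... | inj₂ path = kept-edge e β∉S' ∷ path
    project () [ (fromβ _ _ , _) ] _
    project () ((fromβ _ _ , _) ∷ _) _
    project-β e _ [ (fromβ .e y∈Cv , _) ] y∈Cw      = inj₁ (InC-functional y∈Cv y∈Cw)
    project-β e _ ((fromβ .e z∈Cv , _) ∷ rest) y∈Cw = inj₂ (project z∈Cv rest y∈Cw)

  edge-cut⇒vertex-cut : EdgeMC n E T p → VertexMC V' Adj' T' V∞ p
  edge-cut⇒vertex-cut (S , |S|≤p , S⊆E , separates) =
    S' , ≤-trans (≤-reflexive (length-subdivisions S⊆E)) |S|≤p , subdivisions-deletable S⊆E ,
    λ { _ _ (isT hs) (isT ht) tms≢tmt path →
          separates _ _ hs ht (tm-distinct hs ht tms≢tmt) (project (inTm hs) path (inTm ht)) }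
    where open FromEdgeCut S S⊆E

  edgeOf : V' → Maybe (Fin n × Fin n)
  edgeOf (β u v _) = just (u , v)
  edgeOf _         = nothing

  edgeOf-isEdge : ∀ x → Maybe.All IsEdge (edgeOf x)
  edgeOf-isEdge (cp _ _ _) = Maybe.nothing
  edgeOf-isEdge (tm _ _)   = Maybe.nothing
  edgeOf-isEdge (β _ _ e)  = Maybe.just e

  copyIndexOf : Fin n → V' → Maybe (Fin (suc p))
  copyIndexOf u (cp u' _ i) = if does (u' ≟ᶠ u) then just i else nothing
  copyIndexOf u _           = nothing

  copyIndexOf-cp : ∀ u (h : u ∉ T) i → copyIndexOf u (cp u h i) ≡ just i
  copyIndexOf-cp u h i rewrite dec-true (u ≟ᶠ u) refl = refl

  tm∉cut : ∀ {t h} (S' : List V') → All (λ x → ¬ V∞ x) S' → ¬ (tm t h L.∈ S')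
  tm∉cut (_ ∷ _)  (undeletable ∷ _)  (here refl)  = undeletable (isT _)
  tm∉cut (_ ∷ S') (_ ∷ S'-deletable) (there tm∈S') = tm∉cut S' S'-deletable tm∈S'

  module FromVertexCut (S' : List V') (|S'|≤p : length S' ≤ p)
                       (S'-deletable : All (λ x → ¬ V∞ x) S') where

    S : List (Fin n × Fin n)
    S = mapMaybe edgeOf S'

    S⊆E : All IsEdge S
    S⊆E = All.mapMaybe⁺ {xs = S'} {f = edgeOf}
                        (All.map⁺ {f = edgeOf} (tabulate λ {x} _ → edgeOf-isEdge x))

    -- At most p of the p+1 copies of u lie in S', so some copy index is free.
    free-copy : ∀ u → ∃[ i ] ¬ (i L.∈ mapMaybe (copyIndexOf u) S')
    free-copy u = missing-element p _ (≤-trans (length-mapMaybe (copyIndexOf u) S') |S'|≤p)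

    representative : Fin n → V'
    representative u with u ∈? T
    ... | yes h = tm u h
    ... | no h  = cp u h (proj₁ (free-copy u))

    representative-∈C : ∀ u → InC u (representative u)
    representative-∈C u with u ∈? T
    ... | yes h = inTm h
    ... | no h  = inCp h _

    representative-terminal : ∀ {t} → t ∈ T → T' (representative t)
    representative-terminal {t} h with t ∈? T
    ... | yes h' = isT h'
    ... | no t∉T = contradiction h t∉T

    representative-∉ : ∀ u → ¬ (representative u L.∈ S')
    representative-∉ u with u ∈? T
    ... | yes _ = tm∉cut S' S'-deletable
    ... | no h  = λ cp∈S' → proj₂ (free-copy u) (∈-mapMaybe (copyIndexOf u) (copyIndexOf-cp u h _) cp∈S')

    representative-injective : ∀ {s t} → representative s ≡ representative t → s ≡ t
    representative-injective {s} {t} same =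
      InC-functional (representative-∈C s) (subst (InC t) (sym same) (representative-∈C t))

    lift-edge : ∀ {u v} → (G∖ S) u v → TransClosure (G'∖ S') (representative u) (representative v)
    lift-edge {u} {v} (e , uv∉S) =
      (toβ e (representative-∈C u) , representative-∉ u , β∉S') ∷
      [ (fromβ e (representative-∈C v) , β∉S' , representative-∉ v) ]
      where
      β∉S' : ¬ (β u v e L.∈ S')
      β∉S' β∈S' = uv∉S (∈-mapMaybe edgeOf refl β∈S')

  vertex-cut⇒edge-cut : VertexMC V' Adj' T' V∞ p → EdgeMC n E T p
  vertex-cut⇒edge-cut (S' , |S'|≤p , S'-deletable , separates) =
    S , ≤-trans (length-mapMaybe edgeOf S') |S'|≤p , S⊆E ,
    λ s t hs ht s≢t path →
      separates (representative s) (representative t)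
                (representative-terminal hs) (representative-terminal ht)
                (λ same → s≢t (representative-injective same))
                (lift-path representative lift-edge path)
    where open FromVertexCut S' |S'|≤p S'-deletable

lemma2 : (n : ℕ) (E : Fin n → Fin n → Bool) (T : Subset n) (p : ℕ) →
    EdgeMC n E T p ⇔
      VertexMC (Construction.V' n E T p) (Construction.Adj' n E T p)
               (Construction.T' n E T p) (Construction.V∞ n E T p) p
lemma2 n E T p = mk⇔ edge-cut⇒vertex-cut vertex-cut⇒edge-cut
  where open Reduction n E T p
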